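{- Let $n\ge 1$ and $k\ge 1$ be integers and $w\in C_n$. Then \[ x_k(w)=\begin{cases}\frac{1}{k^n}\binom{\frac{k-1}{2}+n-d(w)}{n} & k \text{ odd},\\[2pt] \frac{1}{k^n}\binom{\frac{k}{2}+n-cd(w)}{n} & k\text{ even}.\end{cases}\]
   Context: $C_n$ is the group of signed permutations of $\{1,\dots,n\}$ (bijections $w$ of $\{\pm1,\dots,\pm n\}$ with $w(-i)=-w(i)$), acting on $\mathbb{R}^n$ by $w(e_i)=\mathrm{sgn}(w(i))e_{|w(i)|}$; it is the Weyl group of type $C_n$ with roots $\pm e_i\pm e_j$ ($i\ne j$), $\pm 2e_i$, positive roots $e_i-e_j$ ($i<j$), $e_i+e_j$, $2e_i$, simple roots $\alpha_i=e_i-e_{i+1}$ ($1\le i\le n-1$), $\alpha_n=2e_n$, and $\alpha_0=-2e_1$ (negative of the highest root). Let $\Pi=\{\alpha_1,\dots,\alpha_n\}$, $\tilde\Pi=\Pi\cup\{\alpha_0\}$, coroot lattice $Y=\mathbb{Z}^n$ with pairing the standard inner product. $\mathrm{Cdes}(w)=\{\alpha\in\tilde\Pi: w(\alpha)\text{ negative}\}$, $cd(w)=|\mathrm{Cdes}(w)|$, $d(w)=|\mathrm{Cdes}(w)\cap\Pi|$. Equivalently, ordering $1<2<\dots<n<-n<\dots<-1$: $w$ has a descent at $i\le n-1$ iff $w(i)>w(i+1)$, at $n$ iff $w(n)<0$, and $\alpha_0\in\mathrm{Cdes}(w)$ iff $w(1)>0$. For $I\subseteq\tilde\Pi$, $a_{k,I}$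 is the number of $y\in Y$ with: if $\alpha_0\in I$: $\langle-\alpha_0,y\rangle=k$, $\langle\alpha_i,y\rangle=0$ for $\alpha_i\in I\setminus\{\alpha_0\}$, $\langle\alpha_i,y\rangle>0$ for $\alpha_i\in\tilde\Pi\setminus I$; if $\alpha_0\notin I$: $\langle-\alpha_0,y\rangle<k$, $\langle\alpha_i,y\rangle=0$ for $\alpha_i\in I$, $\langle\alpha_i,y\rangle>0$ for $\alpha_i\in\Pi\setminus I$. Then $x_k(w)=k^{ -n}\sum_{I\subseteq\tilde\Pi\setminus\mathrm{Cdes}(w)}a_{k,I}$. -}

module Defs where

open import Data.Bool using (Bool; T?; true; false; if_then_else_; not; _∧_; _∨_)
open import Data.Nat as ℕ using (ℕ; zero; suc; _+_; _∸_; _^_; NonZero; _<ᵇ_)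
open import Data.Nat.Properties using (m^n≢0)
open import Data.Integer as ℤ using (ℤ; +_; -[1+_])
open import Data.Fin as Fin using (Fin; zero; suc; toℕ; fromℕ<)
open import Data.Fin.Properties using (toℕ<n)
open import Data.Fin.Permutation using (Permutation′; _⟨$⟩ʳ_)
open import Data.List using (List; []; _∷_; map; filter; length; concatMap; upTo; allFin; foldr)
open import Data.Nat.ListAction using (sum)
open import Data.Rational using (ℚ; _/_)
open import Relation.Nullary using (does; yes; no)
open import Relation.Binary.PropositionalEquality using (_≡_)
open import Data.Nat using (s≤s)

-- Position i : Fin n stands for i+1.
-- w(i+1) = ε(i) · (σ(i)+1), where σ is a permutation of Fin n and
-- ε(i) = − iff  sign i = true.  (This is a bijective encoding of C_n.)

record SignedPerm (n : ℕ) : Set where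
  field
    perm : Permutation′ n
    sign : Fin n → Bool

open SignedPerm public

absIdx : ∀ {n} → SignedPerm n → Fin n → ℕ
absIdx w i = toℕ (perm w ⟨$⟩ʳ i)

-- position of w(i) in the total order 1 < 2 < … < n < −n < … < −1,
-- as a number 0 … 2n−1
key : ∀ {n} → SignedPerm n → Fin n → ℕ
key {n} w i = if sign w i then (2 ℕ.* n) ∸ suc (absIdx w i) else absIdx w i

-- Descent at the simple root α_{j+1} (j : Fin n, 0-based), n = suc m:
--  for j+1 ≤ n−1 : w(j+1) > w(j+2) in the above order;
--  for j+1 = n   : w(n) < 0.
simpleDes : ∀ {m} → SignedPerm (suc m) → Fin (suc m) → Bool
simpleDes {m} w j with toℕ j ℕ.<? m
... | yes j<m = key w (fromℕ< (s≤s j<m)) <ᵇ key w j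
... | no _    = sign w j

-- Cdes(w) as a subset of Π̃ = {α₀, α₁, …, α_n}; index zero is α₀,
-- index suc j is α_{j+1}.  α₀ ∈ Cdes(w) iff w(1) > 0.
Cdes : ∀ {m} → SignedPerm (suc m) → Fin (suc (suc m)) → Bool
Cdes w zero    = not (sign w zero)
Cdes w (suc j) = simpleDes w j

count : ∀ {n} → (Fin n → Bool) → ℕ
count {n} P = sum (map (λ i → if P i then 1 else 0) (allFin n))

d : ∀ {m} → SignedPerm (suc m) → ℕ
d w = count (simpleDes w)

cd : ∀ {m} → SignedPerm (suc m) → ℕ
cd w = count (Cdes w)

-- Roots as vectors in ℤ^n, standard pairing with Y = ℤ^n.

Vecℤ : ℕ → Set
Vecℤ n = Fin n → ℤ

_⟪_⟫ : ∀ {n} → Vecℤ n → Vecℤ n → ℤ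
_⟪_⟫ {n} u v = foldr ℤ._+_ (+ 0) (map (λ c → u c ℤ.* v c) (allFin n))

δ : ℕ → ℕ → ℤ
δ a b = if does (a ℕ.≟ b) then + 1 else + 0

-- simple roots of type C_n (n = suc m), indexed by Fin (suc n):
-- zero ↦ α₀ = −2e₁ ; suc j ↦ α_{j+1} = e_{j+1} − e_{j+2} (j+1 < n), 2e_n (j+1 = n)
α : ∀ {m} → Fin (suc (suc m)) → Vecℤ (suc m)
α zero c = ℤ.- (+ 2 ℤ.* δ (toℕ c) 0)
α {m} (suc j) c with toℕ j ℕ.<? m
... | yes _ = δ (toℕ c) (toℕ j) ℤ.- δ (toℕ c) (suc (toℕ j))
... | no _  = + 2 ℤ.* δ (toℕ c) (toℕ j)

condΠ : ∀ {m} → (Fin (suc (suc m)) → Bool) → Vecℤ (suc m) → Bool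
condΠ {m} I y = foldr _∧_ true (map f (allFin (suc m)))
  where
  f : Fin (suc m) → Bool
  f j = if I (suc j) then does ((α (suc j)) ⟪ y ⟫ ℤ.≟ + 0)
                     else does (+ 0 ℤ.<? (α (suc j)) ⟪ y ⟫)

cond : ∀ {m} → ℕ → (Fin (suc (suc m)) → Bool) → Vecℤ (suc m) → Bool
cond k I y =
  (if I zero then does (ℤ.- (α zero ⟪ y ⟫) ℤ.≟ + k)
             else does (ℤ.- (α zero ⟪ y ⟫) ℤ.<? + k))
  ∧ condΠ I y

cons : ∀ {n} → ℤ → Vecℤ n → Vecℤ (suc n)
cons x v zero    = x
cons x v (suc i) = v i

allVecs : (n : ℕ) → List ℤ → List (Vecℤ n)
allVecs zero    r = (λ ()) ∷ []
allVecs (suc n) r = concatMap (λ x → map (cons x) (allVecs n r)) r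

range : ℕ → List ℤ
range k = map (λ i → + i ℤ.- + k) (upTo (suc (2 ℕ.* k)))

-- a_{k,I}: every y satisfying the conditions has 0 ≤ y_n ≤ … ≤ y_1 and
-- 2y_1 ≤ k, hence lies in the box {−k,…,k}^n; so a_{k,I} is the number
-- of y in that box satisfying the conditions.
a : ∀ {m} → ℕ → (Fin (suc (suc m)) → Bool) → ℕ
a {m} k I = length (filter (λ y → T? (cond k I y))
                           (allVecs (suc m) (range k)))

consB : ∀ {n} → Bool → (Fin n → Bool) → Fin (suc n) → Bool
consB b v zero    = b
consB b v (suc i) = v i

allSubsets : (n : ℕ) → List (Fin n → Bool)
allSubsets zero    = (λ ()) ∷ []
allSubsets (suc n) = concatMap (λ b → map (consB b) (allSubsets n)) (true ∷ false ∷ [])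

disjoint : ∀ {n} → (Fin n → Bool) → (Fin n → Bool) → Bool
disjoint {n} I J = foldr _∧_ true (map (λ i → not (I i ∧ J i)) (allFin n))

_/ᵏ^_ : ℕ → ∀ {k} .{{_ : NonZero k}} → ℕ → ℚ
_/ᵏ^_ c {k} n = _/_ (+ c) (k ^ n) {{m^n≢0 k n}}

x : ∀ {m} (k : ℕ) .{{_ : NonZero k}} → SignedPerm (suc m) → ℚ
x {m} k w =
  _/ᵏ^_ (sum (map (a k) (filter (λ I → T? (disjoint I (Cdes w)))
                                (allSubsets (suc (suc m))))))
        {k} (suc m)

{-# OPTIONS --safe #-}
module Submission where

open import Defs
open import Data.Nat using (ℕ; suc; _∸_; _+_; _/_; _%_; NonZero)
open import Data.Nat.Combinatorics using (_C_)
open import Data.Product using (_×_)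
open import Relation.Binary.PropositionalEquality using (_≡_)

open import Algebra.Properties.CommutativeSemigroup using (interchange; xy∙z≈xz∙y; x∙yz≈y∙xz)
open import Data.Bool using (Bool; true; false; if_then_else_; not; _∧_; T?)
open import Data.Fin using (Fin; zero; suc; toℕ; fromℕ<)
open import Data.Fin.Properties using (toℕ-fromℕ<)
open import Data.Integer as ℤ using (ℤ; +_; -[1+_]; _⊖_; 0ℤ; 1ℤ)
import Data.Integer.Properties as ℤP
open import Data.Integer.Tactic.RingSolver using (solve-∀)
open import Data.List using (List; []; _∷_; map; filter; length; concatMap; allFin; foldr; _++_; upTo)
import Data.List.Properties as List
open import Data.Nat using (zero; _*_; _<_; _≤_; _⊓_; _<?_; s≤s; z≤n; s≤s⁻¹)
open import Data.Nat.Combinatorics using (nCk+nC[k+1]≡[n+1]C[k+1]; k>n⇒nCk≡0)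
open import Data.Nat.DivMod using (m≡m%n+[m/n]*n; m*n/n≡m)
open import Data.Nat.ListAction using (sum)
open import Data.Nat.ListAction.Properties using (sum-++)
import Data.Nat.Properties as ℕ
open import Data.Product using (_,_)
open import Data.Rational using (ℚ)
open import Function using (_∘_; id; mk⇔)
open import Relation.Binary.Definitions using (tri<; tri≈; tri>)
open import Relation.Binary.PropositionalEquality
  using (refl; sym; trans; cong; cong₂; subst; module ≡-Reasoning)
open import Relation.Nullary using (Dec; yes; no; does; ¬_; contradiction)
open import Relation.Nullary.Decidable using (does-⇔; dec-true; dec-false)

-- Exchanging the sum over I with the sum over y turns the numerator of x_k(w) into
-- Σ_y ∏_{α ∈ Π̃} f_α(y), where f_α(y) counts the admissible sides of the wall of α:
-- [⟨α,y⟩ > 0], plus [⟨α,y⟩ = 0] when α ∉ Cdes(w) (for α₀ compare ⟨−α₀,y⟩ = 2y₁ with k).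
-- In coordinates, f_{α_i}(y) = [y_{i+1} + [α_i ∈ Cdes(w)] ≤ y_i] with y_{n+1} = 0, and
-- f_{α₀}(y) = [2y₁ + [α₀ ∈ Cdes(w)] ≤ k], which is [y₁ ≤ (k−1)/2] for odd k and
-- [y₁ + [α₀ ∈ Cdes(w)] ≤ k/2] for even k.  So the numerator counts chains
-- u ≥ y₁ ≥ … ≥ y_n ≥ 0 with c prescribed strict steps, and there are C(u + n − c, n) of
-- them: peel off y₁ and apply the hockey-stick identity.  For odd k the top step is never
-- strict (c = d(w)); for even k it is strict exactly when α₀ ∈ Cdes(w) (c = cd(w)).

𝟙 : Bool → ℕ
𝟙 b = if b then 1 else 0

𝟙≤1 : ∀ b → 𝟙 b ≤ 1
𝟙≤1 true  = ℕ.≤-refl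
𝟙≤1 false = z≤n

𝟙-∧ : ∀ a b → 𝟙 (a ∧ b) ≡ 𝟙 a * 𝟙 b
𝟙-∧ true  b = sym (ℕ.+-identityʳ (𝟙 b))
𝟙-∧ false b = refl

module _ {A : Set} where

  sum-map-cong : ∀ {f g : A → ℕ} xs → (∀ x → f x ≡ g x) → sum (map f xs) ≡ sum (map g xs)
  sum-map-cong xs f≗g = cong sum (List.map-cong f≗g xs)

  sum-map-filter : ∀ (P : A → Bool) (f : A → ℕ) xs →
    sum (map f (filter (T? ∘ P) xs)) ≡ sum (map (λ x → 𝟙 (P x) * f x) xs)
  sum-map-filter P f []       = refl
  sum-map-filter P f (x ∷ xs) with P x
  ... | true  = cong₂ _+_ (sym (ℕ.+-identityʳ (f x))) (sum-map-filter P f xs)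
  ... | false = sum-map-filter P f xs

  length-filter : ∀ (P : A → Bool) xs → length (filter (T? ∘ P) xs) ≡ sum (map (𝟙 ∘ P) xs)
  length-filter P []       = refl
  length-filter P (x ∷ xs) with P x
  ... | true  = cong suc (length-filter P xs)
  ... | false = length-filter P xs

  sum-map-+ : ∀ (f g : A → ℕ) xs →
    sum (map (λ x → f x + g x) xs) ≡ sum (map f xs) + sum (map g xs)
  sum-map-+ f g []       = refl
  sum-map-+ f g (x ∷ xs) = trans (cong (_+_ (f x + g x)) (sum-map-+ f g xs))
                                 (interchange ℕ.+-commutativeSemigroup (f x) (g x) _ _)

  sum-map-*ˡ : ∀ c (f : A → ℕ) xs → sum (map (λ x → c * f x) xs) ≡ c * sum (map f xs)
  sum-map-*ˡ c f []       = sym (ℕ.*-zeroʳ c)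
  sum-map-*ˡ c f (x ∷ xs) = trans (cong (_+_ (c * f x)) (sum-map-*ˡ c f xs))
                                  (sym (ℕ.*-distribˡ-+ c (f x) _))

  sum-map-zero : ∀ xs → sum (map (λ (_ : A) → 0) xs) ≡ 0
  sum-map-zero []       = refl
  sum-map-zero (_ ∷ xs) = sum-map-zero xs

module _ {A B : Set} where

  sum-map-∘ : ∀ (g : B → ℕ) (h : A → B) xs → sum (map g (map h xs)) ≡ sum (map (g ∘ h) xs)
  sum-map-∘ g h xs = cong sum (sym (List.map-∘ xs))

  sum-map-comm : ∀ (f : A → B → ℕ) xs ys →
    sum (map (λ x → sum (map (f x) ys)) xs) ≡ sum (map (λ y → sum (map (λ x → f x y) xs)) ys)
  sum-map-comm f []       ys = sym (sum-map-zero ys)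
  sum-map-comm f (x ∷ xs) ys = trans (cong (_+_ (sum (map (f x) ys))) (sum-map-comm f xs ys))
                                     (sym (sum-map-+ (f x) (λ y → sum (map (λ x → f x y) xs)) ys))

  sum-map-concatMap : ∀ (g : B → ℕ) (h : A → List B) xs →
    sum (map g (concatMap h xs)) ≡ sum (map (λ x → sum (map g (h x))) xs)
  sum-map-concatMap g h []       = refl
  sum-map-concatMap g h (x ∷ xs) = begin
    sum (map g (h x ++ concatMap h xs))               ≡⟨ cong sum (List.map-++ g (h x) _) ⟩
    sum (map g (h x) ++ map g (concatMap h xs))       ≡⟨ sum-++ (map g (h x)) _ ⟩
    sum (map g (h x)) + sum (map g (concatMap h xs))  ≡⟨ cong (_+_ (sum (map g (h x))))
                                                              (sum-map-concatMap g h xs) ⟩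
    sum (map g (h x)) + sum (map (λ x → sum (map g (h x))) xs) ∎
    where open ≡-Reasoning

map-allFin-suc : ∀ {A : Set} n (h : Fin (suc n) → A) →
  map h (allFin (suc n)) ≡ h zero ∷ map (h ∘ suc) (allFin n)
map-allFin-suc n h = cong (h zero ∷_) (trans (List.map-tabulate suc h) (sym (List.map-tabulate id (h ∘ suc))))

count-suc : ∀ {n} (s : Fin (suc n) → Bool) → count s ≡ 𝟙 (s zero) + count (s ∘ suc)
count-suc {n} s = cong sum (map-allFin-suc n (𝟙 ∘ s))

∏ : ∀ n → (Fin n → ℕ) → ℕ
∏ zero    f = 1
∏ (suc n) f = f zero * ∏ n (f ∘ suc)

∏-cong : ∀ n {f g : Fin n → ℕ} → (∀ i → f i ≡ g i) → ∏ n f ≡ ∏ n g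
∏-cong zero    f≗g = refl
∏-cong (suc n) f≗g = cong₂ _*_ (f≗g zero) (∏-cong n (f≗g ∘ suc))

∏-distrib-* : ∀ n (f g : Fin n → ℕ) → ∏ n f * ∏ n g ≡ ∏ n (λ i → f i * g i)
∏-distrib-* zero    f g = refl
∏-distrib-* (suc n) f g = trans (interchange ℕ.*-commutativeSemigroup (f zero) _ (g zero) _)
                                (cong (_*_ (f zero * g zero)) (∏-distrib-* n (f ∘ suc) (g ∘ suc)))

𝟙-all : ∀ n (h : Fin n → Bool) → 𝟙 (foldr _∧_ true (map h (allFin n))) ≡ ∏ n (𝟙 ∘ h)
𝟙-all zero    h = refl
𝟙-all (suc n) h = begin
  𝟙 (foldr _∧_ true (map h (allFin (suc n))))
    ≡⟨ cong (𝟙 ∘ foldr _∧_ true) (map-allFin-suc n h) ⟩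
  𝟙 (h zero ∧ foldr _∧_ true (map (h ∘ suc) (allFin n)))
    ≡⟨ 𝟙-∧ (h zero) _ ⟩
  𝟙 (h zero) * 𝟙 (foldr _∧_ true (map (h ∘ suc) (allFin n)))
    ≡⟨ cong (_*_ (𝟙 (h zero))) (𝟙-all n (h ∘ suc)) ⟩
  ∏ (suc n) (𝟙 ∘ h) ∎
  where open ≡-Reasoning

sum-subsets-∏ : ∀ n (Q : Fin n → Bool → ℕ) →
  sum (map (λ I → ∏ n (λ i → Q i (I i))) (allSubsets n)) ≡ ∏ n (λ i → Q i true + Q i false)
sum-subsets-∏ zero    Q = refl
sum-subsets-∏ (suc n) Q = begin
  sum (map F (concatMap (λ b → map (consB b) S) (true ∷ false ∷ [])))
    ≡⟨ sum-map-concatMap F (λ b → map (consB b) S) (true ∷ false ∷ []) ⟩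
  sum (map F (map (consB true) S)) + (sum (map F (map (consB false) S)) + 0)
    ≡⟨ cong₂ (λ u v → u + (v + 0)) (sum-map-∘ F (consB true) S) (sum-map-∘ F (consB false) S) ⟩
  sum (map (λ I → Q zero true * R I) S) + (sum (map (λ I → Q zero false * R I) S) + 0)
    ≡⟨ cong₂ (λ u v → u + (v + 0)) (sum-map-*ˡ (Q zero true) R S) (sum-map-*ˡ (Q zero false) R S) ⟩
  Q zero true * sum (map R S) + (Q zero false * sum (map R S) + 0)
    ≡⟨ cong (_+_ (Q zero true * sum (map R S))) (ℕ.+-identityʳ _) ⟩
  Q zero true * sum (map R S) + Q zero false * sum (map R S)
    ≡⟨ ℕ.*-distribʳ-+ (sum (map R S)) (Q zero true) (Q zero false) ⟨
  (Q zero true + Q zero false) * sum (map R S)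
    ≡⟨ cong (_*_ (Q zero true + Q zero false)) (sum-subsets-∏ n (Q ∘ suc)) ⟩
  ∏ (suc n) (λ i → Q i true + Q i false) ∎
  where
  open ≡-Reasoning
  S = allSubsets n
  F : (Fin (suc n) → Bool) → ℕ
  F I = ∏ (suc n) (λ i → Q i (I i))
  R : (Fin n → Bool) → ℕ
  R I = ∏ n (λ i → Q (suc i) (I i))

sum-disjoint-subsets-∏ : ∀ n (D : Fin n → Bool) (Q : Fin n → Bool → ℕ) →
  sum (map (λ I → 𝟙 (disjoint I D) * ∏ n (λ i → Q i (I i))) (allSubsets n))
    ≡ ∏ n (λ i → (if D i then 0 else Q i true) + Q i false)
sum-disjoint-subsets-∏ n D Q = begin
  sum (map (λ I → 𝟙 (disjoint I D) * ∏ n (λ i → Q i (I i))) (allSubsets n))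
    ≡⟨ sum-map-cong (allSubsets n) (λ I → trans (cong (_* ∏ n (λ i → Q i (I i)))
                                                      (𝟙-all n (λ i → not (I i ∧ D i))))
                                               (∏-distrib-* n _ _)) ⟩
  sum (map (λ I → ∏ n (λ i → Q′ i (I i))) (allSubsets n))
    ≡⟨ sum-subsets-∏ n Q′ ⟩
  ∏ n (λ i → Q′ i true + Q′ i false)
    ≡⟨ ∏-cong n (λ i → cong₂ _+_ (avoid (D i) (Q i true)) (ℕ.+-identityʳ (Q i false))) ⟩
  ∏ n (λ i → (if D i then 0 else Q i true) + Q i false) ∎
  where
  open ≡-Reasoning
  Q′ : Fin n → Bool → ℕ
  Q′ i b = 𝟙 (not (b ∧ D i)) * Q i b
  avoid : ∀ d q → 𝟙 (not d) * q ≡ (if d then 0 else q)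
  avoid true  q = refl
  avoid false q = ℕ.+-identityʳ q

∑< : ℕ → (ℕ → ℕ) → ℕ
∑< zero    g = 0
∑< (suc n) g = ∑< n g + g n

sum-upTo : ∀ (g : ℕ → ℕ) n → sum (map g (upTo n)) ≡ ∑< n g
sum-upTo g zero    = refl
sum-upTo g (suc n) = begin
  sum (map g (upTo (suc n)))          ≡⟨ cong (sum ∘ map g) (List.upTo-∷ʳ n) ⟨
  sum (map g (upTo n ++ n ∷ []))      ≡⟨ cong sum (List.map-++ g (upTo n) _) ⟩
  sum (map g (upTo n) ++ g n ∷ [])    ≡⟨ sum-++ (map g (upTo n)) _ ⟩
  sum (map g (upTo n)) + (g n + 0)    ≡⟨ cong₂ _+_ (sum-upTo g n) (ℕ.+-identityʳ (g n)) ⟩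
  ∑< n g + g n                        ∎
  where open ≡-Reasoning

∑<-cong : ∀ n {f g : ℕ → ℕ} → (∀ i → i < n → f i ≡ g i) → ∑< n f ≡ ∑< n g
∑<-cong zero    f≗g = refl
∑<-cong (suc n) f≗g = cong₂ _+_ (∑<-cong n (λ i i<n → f≗g i (ℕ.m<n⇒m<1+n i<n))) (f≗g n ℕ.≤-refl)

∑<-𝟙< : ∀ (g : ℕ → ℕ) b n → ∑< n (λ i → 𝟙 (does (i <? b)) * g i) ≡ ∑< (b ⊓ n) g
∑<-𝟙< g b zero    = cong (λ l → ∑< l g) (sym (ℕ.⊓-zeroʳ b))
∑<-𝟙< g b (suc n) = trans (cong (_+ 𝟙 (does (n <? b)) * g n) (∑<-𝟙< g b n)) (last (n <? b))
  where
  open ≡-Reasoning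
  last : Dec (n < b) → ∑< (b ⊓ n) g + 𝟙 (does (n <? b)) * g n ≡ ∑< (b ⊓ suc n) g
  last (yes n<b) = begin
    ∑< (b ⊓ n) g + 𝟙 (does (n <? b)) * g n
      ≡⟨ cong₂ (λ l c → ∑< l g + c * g n) (ℕ.m≥n⇒m⊓n≡n (ℕ.<⇒≤ n<b)) (cong 𝟙 (dec-true (n <? b) n<b)) ⟩
    ∑< n g + 1 * g n
      ≡⟨ cong (_+_ (∑< n g)) (ℕ.*-identityˡ (g n)) ⟩
    ∑< (suc n) g
      ≡⟨ cong (λ l → ∑< l g) (ℕ.m≥n⇒m⊓n≡n n<b) ⟨
    ∑< (b ⊓ suc n) g ∎
  last (no n≮b) = begin
    ∑< (b ⊓ n) g + 𝟙 (does (n <? b)) * g n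
      ≡⟨ cong₂ (λ l c → ∑< l g + c * g n) (ℕ.m≤n⇒m⊓n≡m b≤n) (cong 𝟙 (dec-false (n <? b) n≮b)) ⟩
    ∑< b g + 0
      ≡⟨ ℕ.+-identityʳ (∑< b g) ⟩
    ∑< b g
      ≡⟨ cong (λ l → ∑< l g) (ℕ.m≤n⇒m⊓n≡m (ℕ.m≤n⇒m≤1+n b≤n)) ⟨
    ∑< (b ⊓ suc n) g ∎
    where b≤n = ℕ.≮⇒≥ n≮b

-- Binomial coefficients with an integer top

_C⁺_ : ℤ → ℕ → ℕ
(+ n)    C⁺ k = n C k
-[1+ _ ] C⁺ k = 0

C⁺-pascal : ∀ t k → t C⁺ k + t C⁺ suc k ≡ ℤ.suc t C⁺ suc k
C⁺-pascal (+ n)        k = nCk+nC[k+1]≡[n+1]C[k+1] n k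
C⁺-pascal -[1+ zero ]  k = refl
C⁺-pascal -[1+ suc n ] k = refl

C⁺-< : ∀ {t k} → t ℤ.< + k → t C⁺ k ≡ 0
C⁺-< {+ n}       n<k = k>n⇒nCk≡0 (ℤP.drop‿+<+ n<k)
C⁺-< { -[1+ n ]} _   = refl

C⁺-⊖ : ∀ a b m → (a ⊖ b) C⁺ suc m ≡ (a ∸ b) C suc m
C⁺-⊖ a       zero    m = refl
C⁺-⊖ zero    (suc b) m = refl
C⁺-⊖ (suc a) (suc b) m = trans (cong (_C⁺ suc m) (ℤP.[1+m]⊖[1+n]≡m⊖n a b)) (C⁺-⊖ a b m)

∑<-C⁺ : ∀ t k n → ∑< n (λ i → (t ℤ.+ + i) C⁺ k) + t C⁺ suc k ≡ (t ℤ.+ + n) C⁺ suc k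
∑<-C⁺ t k zero    = cong (_C⁺ suc k) (sym (ℤP.+-identityʳ t))
∑<-C⁺ t k (suc n) = begin
  (∑< n g + g n) + t C⁺ suc k    ≡⟨ xy∙z≈xz∙y ℕ.+-commutativeSemigroup (∑< n g) (g n) _ ⟩
  (∑< n g + t C⁺ suc k) + g n    ≡⟨ cong (_+ g n) (∑<-C⁺ t k n) ⟩
  (t ℤ.+ + n) C⁺ suc k + g n     ≡⟨ ℕ.+-comm _ (g n) ⟩
  g n + (t ℤ.+ + n) C⁺ suc k     ≡⟨ C⁺-pascal (t ℤ.+ + n) k ⟩
  ℤ.suc (t ℤ.+ + n) C⁺ suc k     ≡⟨ cong (_C⁺ suc k) (x∙yz≈y∙xz ℤP.+-commutativeSemigroup 1ℤ t (+ n)) ⟩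
  (t ℤ.+ + suc n) C⁺ suc k       ∎
  where
  open ≡-Reasoning
  g : ℕ → ℕ
  g i = (t ℤ.+ + i) C⁺ k

≤?-by-difference : ∀ i j i′ j′ → j ℤ.- i ≡ j′ ℤ.- i′ → does (i ℤ.≤? j) ≡ does (i′ ℤ.≤? j′)
≤?-by-difference i j i′ j′ e = does-⇔ (mk⇔ to from) (i ℤ.≤? j) (i′ ℤ.≤? j′)
  where
  to : i ℤ.≤ j → i′ ℤ.≤ j′
  to i≤j = ℤP.0≤i-j⇒j≤i (subst (0ℤ ℤ.≤_) e (ℤP.i≤j⇒0≤j-i i≤j))
  from : i′ ℤ.≤ j′ → i ℤ.≤ j
  from i′≤j′ = ℤP.0≤i-j⇒j≤i (subst (0ℤ ℤ.≤_) (sym e) (ℤP.i≤j⇒0≤j-i i′≤j′))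

<?≡+1≤? : ∀ i j → does (i ℤ.<? j) ≡ does (i ℤ.+ 1ℤ ℤ.≤? j)
<?≡+1≤? i j = does-⇔ (mk⇔ (subst (ℤ._≤ j) (ℤP.+-comm 1ℤ i) ∘ ℤP.i<j⇒suc[i]≤j)
                          (ℤP.suc[i]≤j⇒i<j ∘ subst (ℤ._≤ j) (ℤP.+-comm i 1ℤ)))
                     (i ℤ.<? j) (i ℤ.+ 1ℤ ℤ.≤? j)

𝟙-≟-or-< : ∀ (i j : ℤ) b →
  (if b then 0 else 𝟙 (does (i ℤ.≟ j))) + 𝟙 (does (i ℤ.<? j)) ≡ 𝟙 (does (i ℤ.+ + 𝟙 b ℤ.≤? j))
𝟙-≟-or-< i j true  = cong 𝟙 (<?≡+1≤? i j)
𝟙-≟-or-< i j false with ℤP.<-cmp i j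
... | tri< i<j i≢j _
  rewrite dec-false (i ℤ.≟ j) i≢j | dec-true (i ℤ.<? j) i<j
        | dec-true (i ℤ.+ 0ℤ ℤ.≤? j) (subst (ℤ._≤ j) (sym (ℤP.+-identityʳ i)) (ℤP.<⇒≤ i<j)) = refl
... | tri≈ i≮j i≡j _
  rewrite dec-true (i ℤ.≟ j) i≡j | dec-false (i ℤ.<? j) i≮j
        | dec-true (i ℤ.+ 0ℤ ℤ.≤? j) (ℤP.≤-reflexive (trans (ℤP.+-identityʳ i) i≡j)) = refl
... | tri> i≮j i≢j j<i
  rewrite dec-false (i ℤ.≟ j) i≢j | dec-false (i ℤ.<? j) i≮j
        | dec-false (i ℤ.+ 0ℤ ℤ.≤? j) (ℤP.<⇒≱ j<i ∘ subst (ℤ._≤ j) (ℤP.+-identityʳ i)) = refl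

2*≤?2* : ∀ i j → does (+ 2 ℤ.* i ℤ.≤? + 2 ℤ.* j) ≡ does (i ℤ.≤? j)
2*≤?2* i j = does-⇔ (mk⇔ (ℤP.*-cancelˡ-≤-pos i j (+ 2)) (ℤP.*-monoˡ-≤-nonNeg (+ 2)))
                    (+ 2 ℤ.* i ℤ.≤? + 2 ℤ.* j) (i ℤ.≤? j)

2*<?2* : ∀ i j → does (+ 2 ℤ.* i ℤ.<? + 2 ℤ.* j) ≡ does (i ℤ.<? j)
2*<?2* i j = does-⇔ (mk⇔ (ℤP.*-cancelˡ-<-nonNeg (+ 2)) (ℤP.*-monoˡ-<-pos (+ 2)))
                    (+ 2 ℤ.* i ℤ.<? + 2 ℤ.* j) (i ℤ.<? j)

2*+𝟙≤?odd : ∀ y q b → does (+ 2 ℤ.* y ℤ.+ + 𝟙 b ℤ.≤? 1ℤ ℤ.+ + 2 ℤ.* q) ≡ does (y ℤ.≤? q)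
2*+𝟙≤?odd y q false = begin
  does (+ 2 ℤ.* y ℤ.+ 0ℤ ℤ.≤? 1ℤ ℤ.+ + 2 ℤ.* q)
    ≡⟨ ≤?-by-difference (+ 2 ℤ.* y ℤ.+ 0ℤ) (1ℤ ℤ.+ + 2 ℤ.* q)
                        (+ 2 ℤ.* y ℤ.+ 1ℤ) (+ 2 ℤ.* (q ℤ.+ 1ℤ)) (e₁ y q) ⟩
  does (+ 2 ℤ.* y ℤ.+ 1ℤ ℤ.≤? + 2 ℤ.* (q ℤ.+ 1ℤ))   ≡⟨ <?≡+1≤? (+ 2 ℤ.* y) _ ⟨
  does (+ 2 ℤ.* y ℤ.<? + 2 ℤ.* (q ℤ.+ 1ℤ))          ≡⟨ 2*<?2* y (q ℤ.+ 1ℤ) ⟩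
  does (y ℤ.<? q ℤ.+ 1ℤ)                            ≡⟨ <?≡+1≤? y _ ⟩
  does (y ℤ.+ 1ℤ ℤ.≤? q ℤ.+ 1ℤ)                     ≡⟨ ≤?-by-difference (y ℤ.+ 1ℤ) (q ℤ.+ 1ℤ) y q (e₂ y q) ⟩
  does (y ℤ.≤? q)                                   ∎
  where
  open ≡-Reasoning
  e₁ : ∀ y q → (1ℤ ℤ.+ + 2 ℤ.* q) ℤ.- (+ 2 ℤ.* y ℤ.+ 0ℤ) ≡ + 2 ℤ.* (q ℤ.+ 1ℤ) ℤ.- (+ 2 ℤ.* y ℤ.+ 1ℤ)
  e₁ = solve-∀
  e₂ : ∀ y q → (q ℤ.+ 1ℤ) ℤ.- (y ℤ.+ 1ℤ) ≡ q ℤ.- y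
  e₂ = solve-∀
2*+𝟙≤?odd y q true = begin
  does (+ 2 ℤ.* y ℤ.+ 1ℤ ℤ.≤? 1ℤ ℤ.+ + 2 ℤ.* q)
    ≡⟨ ≤?-by-difference (+ 2 ℤ.* y ℤ.+ 1ℤ) (1ℤ ℤ.+ + 2 ℤ.* q) (+ 2 ℤ.* y) (+ 2 ℤ.* q) (e y q) ⟩
  does (+ 2 ℤ.* y ℤ.≤? + 2 ℤ.* q)
    ≡⟨ 2*≤?2* y q ⟩
  does (y ℤ.≤? q) ∎
  where
  open ≡-Reasoning
  e : ∀ y q → (1ℤ ℤ.+ + 2 ℤ.* q) ℤ.- (+ 2 ℤ.* y ℤ.+ 1ℤ) ≡ + 2 ℤ.* q ℤ.- + 2 ℤ.* y
  e = solve-∀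

2*+𝟙≤?even : ∀ y q b → does (+ 2 ℤ.* y ℤ.+ + 𝟙 b ℤ.≤? + 2 ℤ.* q) ≡ does (y ℤ.+ + 𝟙 b ℤ.≤? q)
2*+𝟙≤?even y q false = begin
  does (+ 2 ℤ.* y ℤ.+ 0ℤ ℤ.≤? + 2 ℤ.* q)
    ≡⟨ ≤?-by-difference (+ 2 ℤ.* y ℤ.+ 0ℤ) (+ 2 ℤ.* q) (+ 2 ℤ.* y) (+ 2 ℤ.* q) (e₁ y q) ⟩
  does (+ 2 ℤ.* y ℤ.≤? + 2 ℤ.* q)
    ≡⟨ 2*≤?2* y q ⟩
  does (y ℤ.≤? q)
    ≡⟨ ≤?-by-difference y q (y ℤ.+ 0ℤ) q (e₂ y q) ⟩
  does (y ℤ.+ 0ℤ ℤ.≤? q) ∎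
  where
  open ≡-Reasoning
  e₁ : ∀ y q → + 2 ℤ.* q ℤ.- (+ 2 ℤ.* y ℤ.+ 0ℤ) ≡ + 2 ℤ.* q ℤ.- + 2 ℤ.* y
  e₁ = solve-∀
  e₂ : ∀ y q → q ℤ.- y ≡ q ℤ.- (y ℤ.+ 0ℤ)
  e₂ = solve-∀
2*+𝟙≤?even y q true = begin
  does (+ 2 ℤ.* y ℤ.+ 1ℤ ℤ.≤? + 2 ℤ.* q)   ≡⟨ <?≡+1≤? (+ 2 ℤ.* y) _ ⟨
  does (+ 2 ℤ.* y ℤ.<? + 2 ℤ.* q)          ≡⟨ 2*<?2* y q ⟩
  does (y ℤ.<? q)                          ≡⟨ <?≡+1≤? y q ⟩
  does (y ℤ.+ 1ℤ ℤ.≤? q)                   ∎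
  where open ≡-Reasoning

-- Counting chains

chain : ∀ {n} → (Fin (suc n) → Bool) → ℤ → Vecℤ n → ℕ
chain {zero}  s u y = 𝟙 (does (+ 𝟙 (s zero) ℤ.≤? u))
chain {suc n} s u y = 𝟙 (does (y zero ℤ.+ + 𝟙 (s zero) ℤ.≤? u)) * chain (s ∘ suc) (y zero) (y ∘ suc)

chains : ℕ → ∀ n → (Fin (suc n) → Bool) → ℤ → ℕ
chains k n s u = sum (map (chain s u) (allVecs n (range k)))

chains-suc : ∀ k n (s : Fin (suc (suc n)) → Bool) u →
  chains k (suc n) s u
    ≡ ∑< (suc (2 * k)) (λ i → 𝟙 (does ((+ i ℤ.- + k) ℤ.+ + 𝟙 (s zero) ℤ.≤? u))
                              * chains k n (s ∘ suc) (+ i ℤ.- + k))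
chains-suc k n s u = begin
  sum (map (chain s u) (concatMap (λ x → map (cons x) V) (range k)))
    ≡⟨ sum-map-concatMap (chain s u) (λ x → map (cons x) V) (range k) ⟩
  sum (map (λ x → sum (map (chain s u) (map (cons x) V))) (range k))
    ≡⟨ sum-map-cong (range k) (λ x → trans (sum-map-∘ (chain s u) (cons x) V) (sum-map-*ˡ (top x) _ V)) ⟩
  sum (map (λ x → top x * chains k n (s ∘ suc) x) (map (λ i → + i ℤ.- + k) (upTo (suc (2 * k)))))
    ≡⟨ sum-map-∘ (λ x → top x * chains k n (s ∘ suc) x) (λ i → + i ℤ.- + k) (upTo (suc (2 * k))) ⟩
  sum (map (λ i → top (+ i ℤ.- + k) * chains k n (s ∘ suc) (+ i ℤ.- + k)) (upTo (suc (2 * k))))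
    ≡⟨ sum-upTo _ (suc (2 * k)) ⟩
  ∑< (suc (2 * k)) (λ i → top (+ i ℤ.- + k) * chains k n (s ∘ suc) (+ i ℤ.- + k)) ∎
  where
  open ≡-Reasoning
  V = allVecs n (range k)
  top : ℤ → ℕ
  top x = 𝟙 (does (x ℤ.+ + 𝟙 (s zero) ℤ.≤? u))

𝟙≤?≡C⁺0 : ∀ i j → 𝟙 (does (i ℤ.≤? j)) ≡ (j ℤ.- i) C⁺ 0
𝟙≤?≡C⁺0 i j = trans (cong 𝟙 (≤?-by-difference i j 0ℤ (j ℤ.- i) (sym (ℤP.+-identityʳ (j ℤ.- i)))))
                    (nonNeg (j ℤ.- i))
  where
  nonNeg : ∀ t → 𝟙 (does (0ℤ ℤ.≤? t)) ≡ t C⁺ 0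
  nonNeg (+ _)    = refl
  nonNeg -[1+ _ ] = refl

+𝟙≤?≡<?∸𝟙 : ∀ i j b → does (i + 𝟙 b ℕ.≤? j) ≡ does (i <? suc j ∸ 𝟙 b)
+𝟙≤?≡<?∸𝟙 i j b = does-⇔ (mk⇔ (to b) (from b)) (i + 𝟙 b ℕ.≤? j) (i <? suc j ∸ 𝟙 b)
  where
  to : ∀ b → i + 𝟙 b ≤ j → i < suc j ∸ 𝟙 b
  to false = s≤s ∘ subst (_≤ j) (ℕ.+-identityʳ i)
  to true  = subst (_≤ j) (ℕ.+-comm i 1)
  from : ∀ b → i < suc j ∸ 𝟙 b → i + 𝟙 b ≤ j
  from false = subst (_≤ j) (sym (ℕ.+-identityʳ i)) ∘ s≤s⁻¹
  from true  = subst (_≤ j) (ℕ.+-comm 1 i)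

chains-count : ∀ k n (s : Fin (suc n) → Bool) j → j ≤ 2 * k →
  chains k n s (+ j ℤ.- + k) ≡ (+ j ℤ.- + k ℤ.+ + n ℤ.- + count s) C⁺ n
chains-count k zero s j _ = begin
  𝟙 (does (+ 𝟙 (s zero) ℤ.≤? u)) + 0    ≡⟨ ℕ.+-identityʳ _ ⟩
  𝟙 (does (+ 𝟙 (s zero) ℤ.≤? u))        ≡⟨ 𝟙≤?≡C⁺0 (+ 𝟙 (s zero)) u ⟩
  (u ℤ.- + 𝟙 (s zero)) C⁺ 0             ≡⟨ cong₂ (λ v c → (v ℤ.- + c) C⁺ 0) (sym (ℤP.+-identityʳ u))
                                                                          (sym (ℕ.+-identityʳ (𝟙 (s zero)))) ⟩
  (u ℤ.+ 0ℤ ℤ.- + count s) C⁺ 0         ∎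
  where
  open ≡-Reasoning
  u = + j ℤ.- + k
chains-count k (suc n) s j j≤2k = begin
  chains k (suc n) s u
    ≡⟨ chains-suc k n s u ⟩
  ∑< (suc (2 * k)) (λ i → 𝟙 (does ((+ i ℤ.- + k) ℤ.+ + s₀ ℤ.≤? u)) * chains k n (s ∘ suc) (+ i ℤ.- + k))
    ≡⟨ ∑<-cong (suc (2 * k)) (λ i i≤2k → cong₂ _*_ (cong 𝟙 (shift i)) (inner i (s≤s⁻¹ i≤2k))) ⟩
  ∑< (suc (2 * k)) (λ i → 𝟙 (does (i <? B)) * g i)
    ≡⟨ ∑<-𝟙< g B (suc (2 * k)) ⟩
  ∑< (B ⊓ suc (2 * k)) g
    ≡⟨ cong (λ l → ∑< l g) (ℕ.m≤n⇒m⊓n≡m (ℕ.≤-trans (ℕ.m∸n≤m (suc j) s₀) (s≤s j≤2k))) ⟩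
  ∑< B g
    ≡⟨ trans (cong (_+_ (∑< B g)) (C⁺-< t<1+n)) (ℕ.+-identityʳ (∑< B g)) ⟨
  ∑< B g + t C⁺ suc n
    ≡⟨ ∑<-C⁺ t n B ⟩
  (t ℤ.+ + B) C⁺ suc n
    ≡⟨ cong (_C⁺ suc n) t+B ⟩
  (u ℤ.+ + suc n ℤ.- + count s) C⁺ suc n ∎
  where
  open ≡-Reasoning
  u = + j ℤ.- + k
  s₀ = 𝟙 (s zero)
  c′ = count (s ∘ suc)
  B = suc j ∸ s₀
  t = + n ℤ.- + k ℤ.- + c′
  g : ℕ → ℕ
  g i = (t ℤ.+ + i) C⁺ n
  shift : ∀ i → does ((+ i ℤ.- + k) ℤ.+ + s₀ ℤ.≤? u) ≡ does (i <? B)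
  shift i = trans (≤?-by-difference _ u (+ i ℤ.+ + s₀) (+ j) (e (+ i) (+ j) (+ k) (+ s₀)))
                  (+𝟙≤?≡<?∸𝟙 i j (s zero))
    where
    e : ∀ i j k s → (j ℤ.- k) ℤ.- ((i ℤ.- k) ℤ.+ s) ≡ j ℤ.- (i ℤ.+ s)
    e = solve-∀
  inner : ∀ i → i ≤ 2 * k → chains k n (s ∘ suc) (+ i ℤ.- + k) ≡ g i
  inner i i≤2k = trans (chains-count k n (s ∘ suc) i i≤2k) (cong (_C⁺ n) (e (+ i) (+ k) (+ n) (+ c′)))
    where
    e : ∀ i k n c → i ℤ.- k ℤ.+ n ℤ.- c ≡ n ℤ.- k ℤ.- c ℤ.+ i
    e = solve-∀
  t<1+n : t ℤ.< + suc n
  t<1+n = ℤP.≤-<-trans (ℤP.≤-trans (ℤP.i-j≤i (+ n ℤ.- + k) (+ c′)) (ℤP.i-j≤i (+ n) (+ k)))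
                       (ℤ.+<+ (ℕ.n<1+n n))
  t+B : t ℤ.+ + B ≡ u ℤ.+ + suc n ℤ.- + count s
  t+B = begin
    t ℤ.+ + B                          ≡⟨ cong (ℤ._+_ t) (trans (ℤP.m-n≡m⊖n (suc j) s₀) (ℤP.⊖-≥ s₀≤1+j)) ⟨
    t ℤ.+ (+ suc j ℤ.- + s₀)           ≡⟨ e (+ n) (+ k) (+ c′) (+ j) (+ s₀) ⟩
    u ℤ.+ + suc n ℤ.- (+ s₀ ℤ.+ + c′)  ≡⟨ cong (λ c → u ℤ.+ + suc n ℤ.- + c) (count-suc s) ⟨
    u ℤ.+ + suc n ℤ.- + count s        ∎
    where
    s₀≤1+j : s₀ ≤ suc j
    s₀≤1+j = ℕ.≤-trans (𝟙≤1 (s zero)) (s≤s z≤n)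
    e : ∀ n k c j s → (n ℤ.- k ℤ.- c) ℤ.+ (1ℤ ℤ.+ j ℤ.- s) ≡ j ℤ.- k ℤ.+ (1ℤ ℤ.+ n) ℤ.- (s ℤ.+ c)
    e = solve-∀

chains-ℕ : ∀ k m (s : Fin (suc (suc m)) → Bool) q → q ≤ k →
  chains k (suc m) s (+ q) ≡ (q + suc m ∸ count s) C suc m
chains-ℕ k m s q q≤k = begin
  chains k (suc m) s (+ q)
    ≡⟨ cong (chains k (suc m) s) (e₁ (+ q) (+ k)) ⟩
  chains k (suc m) s (+ (q + k) ℤ.- + k)
    ≡⟨ chains-count k (suc m) s (q + k) q+k≤2k ⟩
  (+ (q + k) ℤ.- + k ℤ.+ + suc m ℤ.- + count s) C⁺ suc m
    ≡⟨ cong (λ t → (t ℤ.- + count s) C⁺ suc m) (e₂ (+ q) (+ k) (+ suc m)) ⟩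
  (+ (q + suc m) ℤ.- + count s) C⁺ suc m
    ≡⟨ cong (_C⁺ suc m) (ℤP.m-n≡m⊖n (q + suc m) (count s)) ⟩
  ((q + suc m) ⊖ count s) C⁺ suc m
    ≡⟨ C⁺-⊖ (q + suc m) (count s) m ⟩
  (q + suc m ∸ count s) C suc m ∎
  where
  open ≡-Reasoning
  q+k≤2k : q + k ≤ 2 * k
  q+k≤2k = subst (q + k ≤_) (cong (_+_ k) (sym (ℕ.+-identityʳ k))) (ℕ.+-monoˡ-≤ k q≤k)
  e₁ : ∀ q k → q ≡ q ℤ.+ k ℤ.- k
  e₁ = solve-∀
  e₂ : ∀ q k n → q ℤ.+ k ℤ.- k ℤ.+ n ≡ q ℤ.+ n
  e₂ = solve-∀

-- Pairings with the roots

⟪⟫-suc : ∀ {n} (u v : Vecℤ (suc n)) → u ⟪ v ⟫ ≡ u zero ℤ.* v zero ℤ.+ (u ∘ suc) ⟪ v ∘ suc ⟫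
⟪⟫-suc {n} u v = cong (foldr ℤ._+_ 0ℤ) (map-allFin-suc n (λ c → u c ℤ.* v c))

⟪⟫-cong : ∀ {n} {u u′ : Vecℤ n} (v : Vecℤ n) → (∀ c → u c ≡ u′ c) → u ⟪ v ⟫ ≡ u′ ⟪ v ⟫
⟪⟫-cong {n} v u≗u′ = cong (foldr ℤ._+_ 0ℤ) (List.map-cong (λ c → cong (ℤ._* v c) (u≗u′ c)) (allFin n))

⟪⟫-zeroˡ : ∀ {n} (v : Vecℤ n) → (λ _ → 0ℤ) ⟪ v ⟫ ≡ 0ℤ
⟪⟫-zeroˡ {zero}  v = refl
⟪⟫-zeroˡ {suc n} v = trans (⟪⟫-suc (λ _ → 0ℤ) v) (cong₂ ℤ._+_ (ℤP.*-zeroˡ (v zero)) (⟪⟫-zeroˡ (v ∘ suc)))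

⟪⟫-linear : ∀ {n} r s (u u′ v : Vecℤ n) →
  (λ c → r ℤ.* u c ℤ.+ s ℤ.* u′ c) ⟪ v ⟫ ≡ r ℤ.* u ⟪ v ⟫ ℤ.+ s ℤ.* u′ ⟪ v ⟫
⟪⟫-linear {zero}  r s u u′ v = sym (cong₂ ℤ._+_ (ℤP.*-zeroʳ r) (ℤP.*-zeroʳ s))
⟪⟫-linear {suc n} r s u u′ v = begin
  (λ c → r ℤ.* u c ℤ.+ s ℤ.* u′ c) ⟪ v ⟫
    ≡⟨ ⟪⟫-suc (λ c → r ℤ.* u c ℤ.+ s ℤ.* u′ c) v ⟩
  w₀ ℤ.* v zero ℤ.+ (λ c → r ℤ.* u (suc c) ℤ.+ s ℤ.* u′ (suc c)) ⟪ v ∘ suc ⟫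
    ≡⟨ cong (ℤ._+_ (w₀ ℤ.* v zero)) (⟪⟫-linear r s (u ∘ suc) (u′ ∘ suc) (v ∘ suc)) ⟩
  w₀ ℤ.* v zero ℤ.+ (r ℤ.* (u ∘ suc) ⟪ v ∘ suc ⟫ ℤ.+ s ℤ.* (u′ ∘ suc) ⟪ v ∘ suc ⟫)
    ≡⟨ regroup r s (u zero) (u′ zero) (v zero) _ _ ⟩
  r ℤ.* (u zero ℤ.* v zero ℤ.+ (u ∘ suc) ⟪ v ∘ suc ⟫) ℤ.+ s ℤ.* (u′ zero ℤ.* v zero ℤ.+ (u′ ∘ suc) ⟪ v ∘ suc ⟫)
    ≡⟨ cong₂ (λ p q → r ℤ.* p ℤ.+ s ℤ.* q) (⟪⟫-suc u v) (⟪⟫-suc u′ v) ⟨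
  r ℤ.* u ⟪ v ⟫ ℤ.+ s ℤ.* u′ ⟪ v ⟫ ∎
  where
  open ≡-Reasoning
  w₀ = r ℤ.* u zero ℤ.+ s ℤ.* u′ zero
  regroup : ∀ r s a a′ b p p′ →
    (r ℤ.* a ℤ.+ s ℤ.* a′) ℤ.* b ℤ.+ (r ℤ.* p ℤ.+ s ℤ.* p′) ≡ r ℤ.* (a ℤ.* b ℤ.+ p) ℤ.+ s ℤ.* (a′ ℤ.* b ℤ.+ p′)
  regroup = solve-∀

⟪δ⟫ : ∀ {n} (v : Vecℤ n) j → (λ c → δ (toℕ c) (toℕ j)) ⟪ v ⟫ ≡ v j
⟪δ⟫ {suc n} v zero = begin
  (λ c → δ (toℕ c) 0) ⟪ v ⟫                   ≡⟨ ⟪⟫-suc (λ c → δ (toℕ c) 0) v ⟩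
  1ℤ ℤ.* v zero ℤ.+ (λ _ → 0ℤ) ⟪ v ∘ suc ⟫   ≡⟨ cong₂ ℤ._+_ (ℤP.*-identityˡ (v zero)) (⟪⟫-zeroˡ (v ∘ suc)) ⟩
  v zero ℤ.+ 0ℤ                               ≡⟨ ℤP.+-identityʳ (v zero) ⟩
  v zero                                      ∎
  where open ≡-Reasoning
⟪δ⟫ {suc n} v (suc j) = begin
  (λ c → δ (toℕ c) (suc (toℕ j))) ⟪ v ⟫    ≡⟨ ⟪⟫-suc (λ c → δ (toℕ c) (suc (toℕ j))) v ⟩
  0ℤ ℤ.* v zero ℤ.+ eⱼ ⟪ v ∘ suc ⟫         ≡⟨ cong (ℤ._+ eⱼ ⟪ v ∘ suc ⟫) (ℤP.*-zeroˡ (v zero)) ⟩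
  0ℤ ℤ.+ eⱼ ⟪ v ∘ suc ⟫                    ≡⟨ ℤP.+-identityˡ _ ⟩
  eⱼ ⟪ v ∘ suc ⟫                           ≡⟨ ⟪δ⟫ (v ∘ suc) j ⟩
  v (suc j)                                ∎
  where
  open ≡-Reasoning
  eⱼ : Vecℤ n
  eⱼ c = δ (toℕ c) (toℕ j)

α₀-pairing : ∀ {m} (y : Vecℤ (suc m)) → ℤ.- (α zero ⟪ y ⟫) ≡ + 2 ℤ.* y zero
α₀-pairing {m} y = begin
  ℤ.- (α zero ⟪ y ⟫)                                  ≡⟨ cong ℤ.-_ (⟪⟫-cong y (λ c → e₁ (e₀ c))) ⟩
  ℤ.- ((λ c → ℤ.- + 2 ℤ.* e₀ c ℤ.+ 0ℤ ℤ.* e₀ c) ⟪ y ⟫) ≡⟨ cong ℤ.-_ (⟪⟫-linear (ℤ.- + 2) 0ℤ e₀ e₀ y) ⟩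
  ℤ.- (ℤ.- + 2 ℤ.* e₀ ⟪ y ⟫ ℤ.+ 0ℤ ℤ.* e₀ ⟪ y ⟫)      ≡⟨ cong (λ t → ℤ.- (ℤ.- + 2 ℤ.* t ℤ.+ 0ℤ ℤ.* t))
                                                              (⟪δ⟫ y zero) ⟩
  ℤ.- (ℤ.- + 2 ℤ.* y zero ℤ.+ 0ℤ ℤ.* y zero)          ≡⟨ e₂ (y zero) ⟩
  + 2 ℤ.* y zero                                      ∎
  where
  open ≡-Reasoning
  e₀ : Vecℤ (suc m)
  e₀ c = δ (toℕ c) 0
  e₁ : ∀ d → ℤ.- (+ 2 ℤ.* d) ≡ ℤ.- + 2 ℤ.* d ℤ.+ 0ℤ ℤ.* d
  e₁ = solve-∀
  e₂ : ∀ t → ℤ.- (ℤ.- + 2 ℤ.* t ℤ.+ 0ℤ ℤ.* t) ≡ + 2 ℤ.* t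
  e₂ = solve-∀

α-inner-pairing : ∀ {m} (y : Vecℤ (suc m)) j (j<m : toℕ j < m) →
  α (suc j) ⟪ y ⟫ ≡ y j ℤ.- y (fromℕ< (s≤s j<m))
α-inner-pairing {m} y j j<m with toℕ j ℕ.<? m
... | no j≮m = contradiction j<m j≮m
... | yes _  = begin
  (λ c → eⱼ c ℤ.- eⱼ₊₁ c) ⟪ y ⟫                    ≡⟨ ⟪⟫-cong y (λ c → e₁ (eⱼ c) (eⱼ₊₁ c)) ⟩
  (λ c → 1ℤ ℤ.* eⱼ c ℤ.+ ℤ.- 1ℤ ℤ.* eⱼ₊₁ c) ⟪ y ⟫   ≡⟨ ⟪⟫-linear 1ℤ (ℤ.- 1ℤ) eⱼ eⱼ₊₁ y ⟩
  1ℤ ℤ.* eⱼ ⟪ y ⟫ ℤ.+ ℤ.- 1ℤ ℤ.* eⱼ₊₁ ⟪ y ⟫         ≡⟨ cong₂ (λ p q → 1ℤ ℤ.* p ℤ.+ ℤ.- 1ℤ ℤ.* q)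
                                                            (⟪δ⟫ y j) eⱼ₊₁⟪y⟫ ⟩
  1ℤ ℤ.* y j ℤ.+ ℤ.- 1ℤ ℤ.* y j′                   ≡⟨ e₂ (y j) (y j′) ⟩
  y j ℤ.- y j′                                     ∎
  where
  open ≡-Reasoning
  j′ = fromℕ< (s≤s j<m)
  eⱼ eⱼ₊₁ : Vecℤ (suc m)
  eⱼ c = δ (toℕ c) (toℕ j)
  eⱼ₊₁ c = δ (toℕ c) (suc (toℕ j))
  eⱼ₊₁⟪y⟫ : eⱼ₊₁ ⟪ y ⟫ ≡ y j′
  eⱼ₊₁⟪y⟫ = trans (cong (λ t → (λ c → δ (toℕ c) t) ⟪ y ⟫) (sym (toℕ-fromℕ< (s≤s j<m)))) (⟪δ⟫ y j′)
  e₁ : ∀ a b → a ℤ.- b ≡ 1ℤ ℤ.* a ℤ.+ ℤ.- 1ℤ ℤ.* b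
  e₁ = solve-∀
  e₂ : ∀ a b → 1ℤ ℤ.* a ℤ.+ ℤ.- 1ℤ ℤ.* b ≡ a ℤ.- b
  e₂ = solve-∀

α-last-pairing : ∀ {m} (y : Vecℤ (suc m)) j → ¬ toℕ j < m → α (suc j) ⟪ y ⟫ ≡ + 2 ℤ.* y j
α-last-pairing {m} y j j≮m with toℕ j ℕ.<? m
... | yes j<m = contradiction j<m j≮m
... | no _    = begin
  (λ c → + 2 ℤ.* eⱼ c) ⟪ y ⟫                  ≡⟨ ⟪⟫-cong y (λ c → e (eⱼ c)) ⟩
  (λ c → + 2 ℤ.* eⱼ c ℤ.+ 0ℤ ℤ.* eⱼ c) ⟪ y ⟫  ≡⟨ ⟪⟫-linear (+ 2) 0ℤ eⱼ eⱼ y ⟩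
  + 2 ℤ.* eⱼ ⟪ y ⟫ ℤ.+ 0ℤ ℤ.* eⱼ ⟪ y ⟫        ≡⟨ cong (λ t → + 2 ℤ.* t ℤ.+ 0ℤ ℤ.* t) (⟪δ⟫ y j) ⟩
  + 2 ℤ.* y j ℤ.+ 0ℤ ℤ.* y j                  ≡⟨ e (y j) ⟨
  + 2 ℤ.* y j                                 ∎
  where
  open ≡-Reasoning
  eⱼ : Vecℤ (suc m)
  eⱼ c = δ (toℕ c) (toℕ j)
  e : ∀ d → + 2 ℤ.* d ≡ + 2 ℤ.* d ℤ.+ 0ℤ ℤ.* d
  e = solve-∀

-- The walls of the alcove

-- onWall = (α_i ∈ I): the equality condition of a_{k,I} for α_i, otherwise the strict one.
wallCond : ∀ {m} → ℕ → Vecℤ (suc m) → Fin (suc (suc m)) → Bool → Bool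
wallCond k y zero    onWall = if onWall then does (ℤ.- (α zero ⟪ y ⟫) ℤ.≟ + k)
                                        else does (ℤ.- (α zero ⟪ y ⟫) ℤ.<? + k)
wallCond k y (suc j) onWall = if onWall then does (α (suc j) ⟪ y ⟫ ℤ.≟ 0ℤ)
                                        else does (0ℤ ℤ.<? α (suc j) ⟪ y ⟫)

𝟙-cond : ∀ {m} k (I : Fin (suc (suc m)) → Bool) y →
  𝟙 (cond k I y) ≡ ∏ (suc (suc m)) (λ i → 𝟙 (wallCond k y i (I i)))
𝟙-cond {m} k I y = trans (𝟙-∧ (wallCond k y zero (I zero)) (condΠ I y))
                         (cong (_*_ (𝟙 (wallCond k y zero (I zero))))
                               (𝟙-all (suc m) (λ j → wallCond k y (suc j) (I (suc j)))))

wallFactor : ∀ {m} → (Fin (suc (suc m)) → Bool) → ℕ → Vecℤ (suc m) → Fin (suc (suc m)) → ℕ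
wallFactor D k y i = (if D i then 0 else 𝟙 (wallCond k y i true)) + 𝟙 (wallCond k y i false)

numerator : ∀ {m} → ℕ → SignedPerm (suc m) → ℕ
numerator {m} k w = sum (map (a k) (filter (λ I → T? (disjoint I (Cdes w))) (allSubsets (suc (suc m)))))

numerator≡sum-∏wallFactor : ∀ {m} k (w : SignedPerm (suc m)) →
  numerator k w ≡ sum (map (λ y → ∏ (suc (suc m)) (wallFactor (Cdes w) k y)) (allVecs (suc m) (range k)))
numerator≡sum-∏wallFactor {m} k w = begin
  sum (map (a k) (filter (λ I → T? (disjoint I D)) S))
    ≡⟨ sum-map-filter (λ I → disjoint I D) (a k) S ⟩
  sum (map (λ I → 𝟙 (disjoint I D) * a k I) S)
    ≡⟨ sum-map-cong S (λ I → trans (cong (_*_ (𝟙 (disjoint I D))) (length-filter (cond k I) Y))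
                                   (sym (sum-map-*ˡ (𝟙 (disjoint I D)) (λ y → 𝟙 (cond k I y)) Y))) ⟩
  sum (map (λ I → sum (map (λ y → 𝟙 (disjoint I D) * 𝟙 (cond k I y)) Y)) S)
    ≡⟨ sum-map-comm (λ I y → 𝟙 (disjoint I D) * 𝟙 (cond k I y)) S Y ⟩
  sum (map (λ y → sum (map (λ I → 𝟙 (disjoint I D) * 𝟙 (cond k I y)) S)) Y)
    ≡⟨ sum-map-cong Y (λ y → trans (sum-map-cong S (λ I → cong (_*_ (𝟙 (disjoint I D))) (𝟙-cond k I y)))
                                   (sum-disjoint-subsets-∏ (suc (suc m)) D (λ i b → 𝟙 (wallCond k y i b)))) ⟩
  sum (map (λ y → ∏ (suc (suc m)) (wallFactor D k y)) Y) ∎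
  where
  open ≡-Reasoning
  D = Cdes w
  S = allSubsets (suc (suc m))
  Y = allVecs (suc m) (range k)

next : ∀ {m} → Vecℤ (suc m) → Fin (suc m) → ℤ
next {zero}  y zero    = 0ℤ
next {suc m} y zero    = y (suc zero)
next {suc m} y (suc j) = next (y ∘ suc) j

next-inner : ∀ {m} (y : Vecℤ (suc m)) j (j<m : toℕ j < m) → next y j ≡ y (fromℕ< (s≤s j<m))
next-inner {suc m} y zero    _         = refl
next-inner {suc m} y (suc j) (s≤s j<m) = next-inner (y ∘ suc) j j<m

next-last : ∀ {m} (y : Vecℤ (suc m)) j → ¬ toℕ j < m → next y j ≡ 0ℤ
next-last {zero}  y zero    _   = refl
next-last {suc m} y zero    j≮m = contradiction (s≤s z≤n) j≮m
next-last {suc m} y (suc j) j≮m = next-last (y ∘ suc) j (j≮m ∘ s≤s)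

wallFactor-α₀ : ∀ {m} D k (y : Vecℤ (suc m)) →
  wallFactor D k y zero ≡ 𝟙 (does (+ 2 ℤ.* y zero ℤ.+ + 𝟙 (D zero) ℤ.≤? + k))
wallFactor-α₀ D k y = trans (𝟙-≟-or-< (ℤ.- (α zero ⟪ y ⟫)) (+ k) (D zero))
                            (cong (λ t → 𝟙 (does (t ℤ.+ + 𝟙 (D zero) ℤ.≤? + k))) (α₀-pairing y))

wallFactor-simple : ∀ {m} D k (y : Vecℤ (suc m)) j →
  wallFactor D k y (suc j) ≡ 𝟙 (does (next y j ℤ.+ + 𝟙 (D (suc j)) ℤ.≤? y j))
wallFactor-simple {m} D k y j = begin
  (if D (suc j) then 0 else 𝟙 (does (p ℤ.≟ 0ℤ))) + 𝟙 (does (0ℤ ℤ.<? p))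
    ≡⟨ cong (λ e → (if D (suc j) then 0 else 𝟙 e) + 𝟙 (does (0ℤ ℤ.<? p)))
            (does-⇔ (mk⇔ sym sym) (p ℤ.≟ 0ℤ) (0ℤ ℤ.≟ p)) ⟩
  (if D (suc j) then 0 else 𝟙 (does (0ℤ ℤ.≟ p))) + 𝟙 (does (0ℤ ℤ.<? p))
    ≡⟨ 𝟙-≟-or-< 0ℤ p (D (suc j)) ⟩
  𝟙 (does (b ℤ.≤? p))
    ≡⟨ cong 𝟙 (by-pairing (toℕ j ℕ.<? m)) ⟩
  𝟙 (does (next y j ℤ.+ b ℤ.≤? y j)) ∎
  where
  open ≡-Reasoning
  p = α (suc j) ⟪ y ⟫
  b = + 𝟙 (D (suc j))
  by-pairing : Dec (toℕ j < m) → does (b ℤ.≤? p) ≡ does (next y j ℤ.+ b ℤ.≤? y j)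
  by-pairing (yes j<m) = begin
    does (b ℤ.≤? p)                 ≡⟨ cong (λ t → does (b ℤ.≤? t)) (α-inner-pairing y j j<m) ⟩
    does (b ℤ.≤? y j ℤ.- y j′)      ≡⟨ ≤?-by-difference b (y j ℤ.- y j′) (y j′ ℤ.+ b) (y j)
                                                        (e (y j) (y j′) b) ⟩
    does (y j′ ℤ.+ b ℤ.≤? y j)      ≡⟨ cong (λ t → does (t ℤ.+ b ℤ.≤? y j)) (next-inner y j j<m) ⟨
    does (next y j ℤ.+ b ℤ.≤? y j)  ∎
    where
    j′ = fromℕ< (s≤s j<m)
    e : ∀ a a′ b → (a ℤ.- a′) ℤ.- b ≡ a ℤ.- (a′ ℤ.+ b)
    e = solve-∀
  by-pairing (no j≮m) = begin
    does (b ℤ.≤? p)                 ≡⟨ cong (λ t → does (b ℤ.≤? t)) (α-last-pairing y j j≮m) ⟩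
    does (b ℤ.≤? + 2 ℤ.* y j)       ≡⟨ 2*+𝟙≤?even 0ℤ (y j) (D (suc j)) ⟩
    does (0ℤ ℤ.+ b ℤ.≤? y j)        ≡⟨ cong (λ t → does (t ℤ.+ b ℤ.≤? y j)) (next-last y j j≮m) ⟨
    does (next y j ℤ.+ b ℤ.≤? y j)  ∎

∏-next≡chain : ∀ n (s : Fin (suc n) → Bool) (y : Vecℤ (suc n)) →
  ∏ (suc n) (λ j → 𝟙 (does (next y j ℤ.+ + 𝟙 (s j) ℤ.≤? y j))) ≡ chain s (y zero) (y ∘ suc)
∏-next≡chain zero    s y = ℕ.*-identityʳ _
∏-next≡chain (suc n) s y = cong (_*_ (𝟙 (does (y (suc zero) ℤ.+ + 𝟙 (s zero) ℤ.≤? y zero))))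
                                (∏-next≡chain n (s ∘ suc) (y ∘ suc))

∏-wallFactor : ∀ {m} D k (y : Vecℤ (suc m)) →
  ∏ (suc (suc m)) (wallFactor D k y)
    ≡ 𝟙 (does (+ 2 ℤ.* y zero ℤ.+ + 𝟙 (D zero) ℤ.≤? + k)) * chain (D ∘ suc) (y zero) (y ∘ suc)
∏-wallFactor {m} D k y = cong₂ _*_ (wallFactor-α₀ D k y)
                                   (trans (∏-cong (suc m) (wallFactor-simple D k y)) (∏-next≡chain m (D ∘ suc) y))

numerator≡C : ∀ {m} k (w : SignedPerm (suc m)) b q → q ≤ k →
  (∀ y → does (+ 2 ℤ.* y ℤ.+ + 𝟙 (Cdes w zero) ℤ.≤? + k) ≡ does (y ℤ.+ + 𝟙 b ℤ.≤? + q)) →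
  numerator k w ≡ (q + suc m ∸ (𝟙 b + d w)) C suc m
numerator≡C {m} k w b q q≤k top = begin
  numerator k w
    ≡⟨ numerator≡sum-∏wallFactor k w ⟩
  sum (map (λ y → ∏ (suc (suc m)) (wallFactor D k y)) (allVecs (suc m) (range k)))
    ≡⟨ sum-map-cong (allVecs (suc m) (range k))
                    (λ y → trans (∏-wallFactor D k y)
                                 (cong (λ t → 𝟙 t * chain (D ∘ suc) (y zero) (y ∘ suc)) (top (y zero)))) ⟩
  chains k (suc m) (consB b (D ∘ suc)) (+ q)
    ≡⟨ chains-ℕ k m (consB b (D ∘ suc)) q q≤k ⟩
  (q + suc m ∸ count (consB b (D ∘ suc))) C suc m
    ≡⟨ cong (λ c → (q + suc m ∸ c) C suc m) (count-suc (consB b (D ∘ suc))) ⟩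
  (q + suc m ∸ (𝟙 b + d w)) C suc m ∎
  where
  open ≡-Reasoning
  D = Cdes w

numerator-odd : ∀ {m} k q (w : SignedPerm (suc m)) → k ≡ suc (q * 2) →
  numerator k w ≡ (q + suc m ∸ d w) C suc m
numerator-odd k q w k≡1+2q = numerator≡C k w false q q≤k top
  where
  q≤k : q ≤ k
  q≤k = subst (q ≤_) (sym k≡1+2q) (ℕ.m≤n⇒m≤1+n (ℕ.m≤m*n q 2))
  top : ∀ y → does (+ 2 ℤ.* y ℤ.+ + 𝟙 (Cdes w zero) ℤ.≤? + k) ≡ does (y ℤ.+ 0ℤ ℤ.≤? + q)
  top y = begin
    does (+ 2 ℤ.* y ℤ.+ + 𝟙 (Cdes w zero) ℤ.≤? + k)
      ≡⟨ cong (λ h → does (+ 2 ℤ.* y ℤ.+ + 𝟙 (Cdes w zero) ℤ.≤? h))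
              (trans (cong +_ k≡1+2q) (cong (ℤ._+_ 1ℤ) (trans (ℤP.pos-* q 2) (ℤP.*-comm (+ q) (+ 2))))) ⟩
    does (+ 2 ℤ.* y ℤ.+ + 𝟙 (Cdes w zero) ℤ.≤? 1ℤ ℤ.+ + 2 ℤ.* + q)
      ≡⟨ 2*+𝟙≤?odd y (+ q) (Cdes w zero) ⟩
    does (y ℤ.≤? + q)
      ≡⟨ cong (λ h → does (h ℤ.≤? + q)) (ℤP.+-identityʳ y) ⟨
    does (y ℤ.+ 0ℤ ℤ.≤? + q) ∎
    where open ≡-Reasoning

numerator-even : ∀ {m} k q (w : SignedPerm (suc m)) → k ≡ q * 2 →
  numerator k w ≡ (q + suc m ∸ cd w) C suc m
numerator-even {m} k q w k≡2q =
  trans (numerator≡C k w (Cdes w zero) q q≤k top) (cong (λ c → (q + suc m ∸ c) C suc m) (sym (count-suc (Cdes w))))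
  where
  q≤k : q ≤ k
  q≤k = subst (q ≤_) (sym k≡2q) (ℕ.m≤m*n q 2)
  top : ∀ y → does (+ 2 ℤ.* y ℤ.+ + 𝟙 (Cdes w zero) ℤ.≤? + k) ≡ does (y ℤ.+ + 𝟙 (Cdes w zero) ℤ.≤? + q)
  top y = trans (cong (λ h → does (+ 2 ℤ.* y ℤ.+ + 𝟙 (Cdes w zero) ℤ.≤? h))
                      (trans (cong +_ k≡2q) (trans (ℤP.pos-* q 2) (ℤP.*-comm (+ q) (+ 2)))))
                (2*+𝟙≤?even y (+ q) (Cdes w zero))

lemma4 : (m k : ℕ) .{{_ : NonZero k}} (w : SignedPerm (suc m)) →
    (k % 2 ≡ 1 → x k w ≡ _/ᵏ^_ ((((k ∸ 1) / 2) + suc m ∸ d w) C suc m) {k} (suc m))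
    × (k % 2 ≡ 0 → x k w ≡ _/ᵏ^_ (((k / 2) + suc m ∸ cd w) C suc m) {k} (suc m))
lemma4 m k w = odd , even
  where
  q = k / 2
  ratio : ℕ → ℚ
  ratio c = _/ᵏ^_ c {k} (suc m)
  odd : k % 2 ≡ 1 → x k w ≡ ratio ((((k ∸ 1) / 2) + suc m ∸ d w) C suc m)
  odd k%2≡1 = cong ratio (trans (numerator-odd k q w k≡1+2q)
                                (cong (λ h → (h + suc m ∸ d w) C suc m) (sym [k∸1]/2≡q)))
    where
    k≡1+2q : k ≡ suc (q * 2)
    k≡1+2q = trans (m≡m%n+[m/n]*n k 2) (cong (_+ q * 2) k%2≡1)
    [k∸1]/2≡q : (k ∸ 1) / 2 ≡ q
    [k∸1]/2≡q = trans (cong (λ h → (h ∸ 1) / 2) k≡1+2q) (m*n/n≡m q 2)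
  even : k % 2 ≡ 0 → x k w ≡ ratio (((k / 2) + suc m ∸ cd w) C suc m)
  even k%2≡0 = cong ratio (numerator-even k q w (trans (m≡m%n+[m/n]*n k 2) (cong (_+ q * 2) k%2≡0)))
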